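{- A set $T\subseteq\mathbb{Z}^n$ is a packing with $\Upsilon_n$ (i.e. the translates $X+\Upsilon_n$, $X\in T$, are pairwise disjoint) if and only if $d_C(X,Y)\ge3$ for every two distinct elements $X,Y\in T$.
   Context: $\Upsilon_n=\{U\in\mathbb{Z}^n:\sum_i|x_i-u_i|\le1\text{ for some }X\in\{ -1,0\}^n\}$. The cross distance is $d_C(X,Y)=\sum_{i=1}^n\max\{0,|y_i-x_i|-1\}$ for $X,Y\in\mathbb{Z}^n$. -}

module Defs where

open import Data.Nat as ℕ using (ℕ; _∸_)
open import Data.Integer as ℤ using (ℤ; _-_; ∣_∣; -1ℤ; 0ℤ)
open import Data.Vec using (Vec; []; _∷_; zipWith; foldr)
open import Data.Vec.Relation.Unary.All using (All)
open import Data.Product using (Σ; ∃; _×_)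
open import Data.Sum using (_⊎_)
open import Relation.Binary.PropositionalEquality using (_≡_)
open import Relation.Nullary using (¬_)
open import Level using (0ℓ; suc)

Point : ℕ → Set
Point n = Vec ℤ n

sumℕ : ∀ {n} → Vec ℕ n → ℕ
sumℕ = foldr _ ℕ._+_ 0

l1 : ∀ {n} → Point n → Point n → ℕ
l1 X U = sumℕ (zipWith (λ x u → ∣ x - u ∣) X U)

-- cross distance  d_C(X,Y) = Σ_i max{0, |y_i - x_i| - 1}   (truncated subtraction = max{0,·})
dC : ∀ {n} → Point n → Point n → ℕ
dC X Y = sumℕ (zipWith (λ x y → ∣ y - x ∣ ∸ 1) X Y)

IsCornerVec : ∀ {n} → Point n → Set
IsCornerVec X = All (λ x → (x ≡ -1ℤ) ⊎ (x ≡ 0ℤ)) X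

Υ : (n : ℕ) → Point n → Set
Υ n U = Σ (Point n) λ X → IsCornerVec X × (l1 X U ℕ.≤ 1)

InTranslate : ∀ {n} → Point n → Point n → Set
InTranslate {n} X Z = Υ n (zipWith _-_ Z X)

Subset : ℕ → Set₁
Subset n = Point n → Set

IsPacking : ∀ {n} → Subset n → Set
IsPacking {n} T = ∀ X Y → T X → T Y → ¬ (X ≡ Y) →
  ¬ (Σ (Point n) λ Z → InTranslate X Z × InTranslate Y Z)

module Submission where

-- Proof idea.  Write Z - X ∈ Υ_n as "some corner A ∈ {-1,0}^n has ℓ¹(A, Z - X) ≤ 1".
-- The whole statement then reduces to one metric fact:
--
--   the translates X + Υ_n and Y + Υ_n intersect   iff   d_C(X,Y) ≤ 2.
--
-- Both directions are proved coordinatewise, for arbitrary budgets p, q instead of 1, 1: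
--  * lower bound: two corner coordinates differ by at most 1, so the triangle inequality
--    gives |y - x| ∸ 1 ≤ |a - (z - x)| + |b - (z - y)|; summing, d_C(X,Y) is a lower bound
--    for ℓ¹(A, Z - X) + ℓ¹(B, Z - Y);
--  * realisation: in one coordinate a suitable pair of corners shortens the gap y - x to
--    |y - x| ∸ 1, and ℤ is geodesic, so a point z splits the remaining gap into pieces of
--    length ≤ p and ≤ q; a budget p + q ≥ d_C(X,Y) can be split among the coordinates.

open import Defs
open import Data.Nat using (ℕ; _≥_)
open import Relation.Binary.PropositionalEquality using (_≡_)
open import Relation.Nullary using (¬_)
open import Data.Product using (_×_)

open import Data.Nat as ℕ using (zero; suc; _≤_; _∸_; z≤n; s≤s; _≤?_)
open import Data.Nat.Properties as ℕP using (≤-trans; ≤-reflexive; +-mono-≤; m≤n+o⇒m∸n≤o)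
open import Algebra.Properties.CommutativeSemigroup ℕP.+-commutativeSemigroup using (interchange)
open import Data.Integer as ℤ using (ℤ; +_; -[1+_]; _-_; -_; ∣_∣; -1ℤ; 0ℤ)
import Data.Integer.Properties as ℤP
open import Data.Integer.Solver using (module +-*-Solver)
open import Data.Vec using ([]; _∷_; zipWith)
open import Data.Vec.Relation.Unary.All using ([]; _∷_)
open import Data.Product using (Σ; _,_)
open import Data.Sum using (_⊎_; inj₁; inj₂)
open import Relation.Binary.PropositionalEquality using (refl; sym; trans; cong; subst; module ≡-Reasoning)
open import Relation.Nullary using (yes; no)
open import Data.Empty using (⊥-elim)

IsCorner : ℤ → Set
IsCorner a = (a ≡ -1ℤ) ⊎ (a ≡ 0ℤ)

Meet : ∀ {n} → Point n → Point n → Set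
Meet {n} X Y = Σ (Point n) λ Z → InTranslate X Z × InTranslate Y Z

module Identities where
  open +-*-Solver

  gap-decomposition : ∀ x y z a b →
    y - x ≡ (a - b) ℤ.+ ((b - (z - y)) - (a - (z - x)))
  gap-decomposition = solve 5 (λ x y z a b →
    y :- x := (a :- b) :+ ((b :- (z :- y)) :- (a :- (z :- x)))) refl

  offset-from-x : ∀ x a s → a - ((x ℤ.+ (a ℤ.+ s)) - x) ≡ - s
  offset-from-x = solve 3 (λ x a s → a :- ((x :+ (a :+ s)) :- x) := :- s) refl

  offset-from-y : ∀ x y a b s →
    b - ((x ℤ.+ (a ℤ.+ s)) - y) ≡ ((y - x) - (a - b)) - s
  offset-from-y = solve 5 (λ x y a b s →
    b :- ((x :+ (a :+ s)) :- y) := ((y :- x) :- (a :- b)) :- s) refl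

  negate-split : ∀ e s → e - (- s) ≡ - ((- e) - s)
  negate-split = solve 2 (λ e s → e :- (:- s) := :- ((:- e) :- s)) refl

open Identities

corner-distance : ∀ {a b} → IsCorner a → IsCorner b → ∣ a - b ∣ ≤ 1
corner-distance (inj₁ refl) (inj₁ refl) = z≤n
corner-distance (inj₁ refl) (inj₂ refl) = s≤s z≤n
corner-distance (inj₂ refl) (inj₁ refl) = s≤s z≤n
corner-distance (inj₂ refl) (inj₂ refl) = z≤n

coordinate-lower-bound : ∀ x y z {a b} → IsCorner a → IsCorner b →
  ∣ y - x ∣ ∸ 1 ≤ ∣ a - (z - x) ∣ ℕ.+ ∣ b - (z - y) ∣
coordinate-lower-bound x y z {a} {b} ca cb = m≤n+o⇒m∸n≤o ∣ y - x ∣ 1 gap≤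
  where
  u = a - (z - x)
  v = b - (z - y)
  gap≤ : ∣ y - x ∣ ≤ 1 ℕ.+ (∣ u ∣ ℕ.+ ∣ v ∣)
  gap≤ = subst (λ t → ∣ t ∣ ≤ 1 ℕ.+ (∣ u ∣ ℕ.+ ∣ v ∣)) (sym (gap-decomposition x y z a b))
    (≤-trans (ℤP.∣i+j∣≤∣i∣+∣j∣ (a - b) (v - u))
      (+-mono-≤ (corner-distance ca cb)
        (subst (∣ v - u ∣ ≤_) (ℕP.+-comm ∣ v ∣ ∣ u ∣) (ℤP.∣i-j∣≤∣i∣+∣j∣ v u))))

cross-lower-bound : ∀ {n} (X Y Z A B : Point n) → IsCornerVec A → IsCornerVec B →
  dC X Y ≤ l1 A (zipWith _-_ Z X) ℕ.+ l1 B (zipWith _-_ Z Y)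
cross-lower-bound [] [] [] [] [] [] [] = z≤n
cross-lower-bound (x ∷ X) (y ∷ Y) (z ∷ Z) (a ∷ A) (b ∷ B) (ca ∷ cA) (cb ∷ cB) =
  subst (dC (x ∷ X) (y ∷ Y) ≤_)
    (interchange ∣ a - (z - x) ∣ ∣ b - (z - y) ∣ (l1 A (zipWith _-_ Z X)) (l1 B (zipWith _-_ Z Y)))
    (+-mono-≤ (coordinate-lower-bound x y z ca cb) (cross-lower-bound X Y Z A B cA cB))

corner-shortening : ∀ d →
  Σ ℤ λ a → Σ ℤ λ b → IsCorner a × IsCorner b × ∣ d - (a - b) ∣ ≡ ∣ d ∣ ∸ 1
corner-shortening (+ zero)  = 0ℤ , 0ℤ , inj₂ refl , inj₂ refl , refl
corner-shortening (+ suc k) = 0ℤ , -1ℤ , inj₂ refl , inj₁ refl , refl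
corner-shortening -[1+ k ]  = -1ℤ , 0ℤ , inj₁ refl , inj₂ refl , ℤP.∣m⊖n∣≡∣n⊖m∣ 1 (suc k)

geodesic-ℕ : ∀ k p q → k ≤ p ℕ.+ q → Σ ℤ λ s → ∣ s ∣ ≤ p × ∣ + k - s ∣ ≤ q
geodesic-ℕ k p q k≤p+q with k ≤? p
... | yes k≤p = + k , k≤p , ≤-trans (≤-reflexive (cong ∣_∣ (ℤP.+-inverseʳ (+ k)))) z≤n
... | no  k≰p = + p , ℕP.≤-refl , ≤-trans (≤-reflexive rest≡) (m≤n+o⇒m∸n≤o k p k≤p+q)
  where
  open ≡-Reasoning
  rest≡ : ∣ + k - + p ∣ ≡ k ∸ p
  rest≡ = begin
    ∣ + k - + p ∣     ≡⟨ cong ∣_∣ (ℤP.m-n≡m⊖n k p) ⟩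
    ∣ k ℤ.⊖ p ∣       ≡⟨ cong ∣_∣ (ℤP.⊖-≥ (ℕP.<⇒≤ (ℕP.≰⇒> k≰p))) ⟩
    k ∸ p             ∎

geodesic : ∀ e p q → ∣ e ∣ ≤ p ℕ.+ q → Σ ℤ λ s → ∣ s ∣ ≤ p × ∣ e - s ∣ ≤ q
geodesic (+ k) p q le = geodesic-ℕ k p q le
geodesic -[1+ k ] p q le with geodesic-ℕ (suc k) p q le
... | s , s≤p , rest≤q =
  - s , subst (_≤ p) (sym (ℤP.∣-i∣≡∣i∣ s)) s≤p ,
  subst (_≤ q) (sym (trans (cong ∣_∣ (negate-split -[1+ k ] s)) (ℤP.∣-i∣≡∣i∣ (+ suc k - s)))) rest≤q

coordinate-realisation : ∀ x y p q → ∣ y - x ∣ ∸ 1 ≤ p ℕ.+ q →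
  Σ ℤ λ z → Σ ℤ λ a → Σ ℤ λ b →
    IsCorner a × IsCorner b × ∣ a - (z - x) ∣ ≤ p × ∣ b - (z - y) ∣ ≤ q
coordinate-realisation x y p q le
  with corner-shortening (y - x)
... | a , b , ca , cb , shortened
  with geodesic ((y - x) - (a - b)) p q (subst (_≤ p ℕ.+ q) (sym shortened) le)
... | s , s≤p , rest≤q =
  x ℤ.+ (a ℤ.+ s) , a , b , ca , cb ,
  subst (_≤ p) (sym (trans (cong ∣_∣ (offset-from-x x a s)) (ℤP.∣-i∣≡∣i∣ s))) s≤p ,
  subst (_≤ q) (sym (cong ∣_∣ (offset-from-y x y a b s))) rest≤q

record BudgetSplit (c r p q : ℕ) : Set where
  field
    p₁ q₁ p₂ q₂ : ℕ
    covers₁ : c ≤ p₁ ℕ.+ q₁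
    covers₂ : r ≤ p₂ ℕ.+ q₂
    sum-p : p₁ ℕ.+ p₂ ≡ p
    sum-q : q₁ ℕ.+ q₂ ≡ q

split-budget : ∀ c r p q → c ℕ.+ r ≤ p ℕ.+ q → BudgetSplit c r p q
split-budget zero r p q le = record
  { p₁ = 0 ; q₁ = 0 ; p₂ = p ; q₂ = q
  ; covers₁ = z≤n ; covers₂ = le ; sum-p = refl ; sum-q = refl }
split-budget (suc c) r (suc p) q (s≤s le) =
  let open BudgetSplit (split-budget c r p q le) in record
  { p₁ = suc p₁ ; q₁ = q₁ ; p₂ = p₂ ; q₂ = q₂
  ; covers₁ = s≤s covers₁ ; covers₂ = covers₂ ; sum-p = cong suc sum-p ; sum-q = sum-q }
split-budget (suc c) r zero (suc q) (s≤s le) =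
  let open BudgetSplit (split-budget c r zero q le) in record
  { p₁ = p₁ ; q₁ = suc q₁ ; p₂ = p₂ ; q₂ = q₂
  ; covers₁ = subst (suc c ≤_) (sym (ℕP.+-suc p₁ q₁)) (s≤s covers₁) ; covers₂ = covers₂ ; sum-p = sum-p ; sum-q = cong suc sum-q }
split-budget (suc c) r zero zero ()

cross-realisation : ∀ {n} (X Y : Point n) p q → dC X Y ≤ p ℕ.+ q →
  Σ (Point n) λ Z → Σ (Point n) λ A → Σ (Point n) λ B →
    IsCornerVec A × IsCornerVec B × l1 A (zipWith _-_ Z X) ≤ p × l1 B (zipWith _-_ Z Y) ≤ q
cross-realisation [] [] p q le = [] , [] , [] , [] , [] , z≤n , z≤n
cross-realisation (x ∷ X) (y ∷ Y) p q le
  with split-budget (∣ y - x ∣ ∸ 1) (dC X Y) p q le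
... | budget
  with coordinate-realisation x y (p₁ budget) (q₁ budget) (covers₁ budget)
     | cross-realisation X Y (p₂ budget) (q₂ budget) (covers₂ budget)
  where open BudgetSplit
... | z , a , b , ca , cb , a≤ , b≤ | Z , A , B , cA , cB , A≤ , B≤ =
  z ∷ Z , a ∷ A , b ∷ B , ca ∷ cA , cb ∷ cB ,
  ≤-trans (+-mono-≤ a≤ A≤) (≤-reflexive (BudgetSplit.sum-p budget)) ,
  ≤-trans (+-mono-≤ b≤ B≤) (≤-reflexive (BudgetSplit.sum-q budget))

meet⇒close : ∀ {n} (X Y : Point n) → Meet X Y → dC X Y ≤ 2
meet⇒close X Y (Z , (A , cA , A≤1) , (B , cB , B≤1)) =
  ≤-trans (cross-lower-bound X Y Z A B cA cB) (+-mono-≤ A≤1 B≤1)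

close⇒meet : ∀ {n} (X Y : Point n) → dC X Y ≤ 2 → Meet X Y
close⇒meet X Y le with cross-realisation X Y 1 1 le
... | Z , A , B , cA , cB , A≤1 , B≤1 = Z , (A , cA , A≤1) , (B , cB , B≤1)

corollary3 : (n : ℕ) (T : Subset n) →
    (IsPacking T → ∀ X Y → T X → T Y → ¬ (X ≡ Y) → dC X Y ≥ 3) ×
    ((∀ X Y → T X → T Y → ¬ (X ≡ Y) → dC X Y ≥ 3) → IsPacking T)
corollary3 n T = packing⇒far , far⇒packing
  where
  packing⇒far : IsPacking T → ∀ X Y → T X → T Y → ¬ (X ≡ Y) → dC X Y ≥ 3
  packing⇒far packing X Y tX tY X≢Y with dC X Y ≤? 2
  ... | yes close = ⊥-elim (packing X Y tX tY X≢Y (close⇒meet X Y close))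
  ... | no  far   = ℕP.≰⇒> far

  far⇒packing : (∀ X Y → T X → T Y → ¬ (X ≡ Y) → dC X Y ≥ 3) → IsPacking T
  far⇒packing far X Y tX tY X≢Y meet = ℕP.<⇒≱ (far X Y tX tY X≢Y) (meet⇒close X Y meet)
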